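{- Let $k$ be a positive integer, $s=\lceil k/12\rceil$, let $D$ be a $\mathcal K_{2,s}$-free digraph, and let $S$ be a set of at most $k$ vertices of $D$. Then for any three distinct vertices $a,b,c$ of $D$ and any signs $\star_a,\star_b,\star_c\in\{+,-\}$, $$|N^{\star_a}(a)\cap S|+|N^{\star_b}(b)\cap S|+|N^{\star_c}(c)\cap S|<5k/4.$$
   Context: A digraph is finite, without loops or parallel arcs, but may contain both $xy$ and $yx$. $N^+(x)$ and $N^-(x)$ are the out- and in-neighbourhoods of $x$. $D$ is $\mathcal K_{2,s}$-free if it contains none of the three orientations of $K_{2,s}$ in which each of the two vertices of the class of size two has out-degree $0$ or in-degree $0$. -}

module Defs where

open import Data.Nat using (ℕ; _+_; _/_)
open import Data.Fin using (Fin)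
open import Data.Fin.Subset using (Subset; _∩_; ∣_∣)
open import Data.Vec using (tabulate)
open import Data.Bool using (Bool; true; false)
open import Data.Product using (Σ; _×_; ∃)
open import Relation.Nullary using (¬_; Dec)
open import Relation.Nullary.Decidable using (⌊_⌋)
open import Relation.Binary.PropositionalEquality using (_≡_; _≢_)
open import Function.Definitions using (Injective)

-- A digraph on the vertex set Fin n: a decidable arc relation without loops.
-- (No parallel arcs by construction; both xy and yx may be present.)
record Digraph (n : ℕ) : Set₁ where
  field
    Arc     : Fin n → Fin n → Set
    arc?    : (x y : Fin n) → Dec (Arc x y)
    noLoops : (x : Fin n) → ¬ Arc x x
open Digraph public

data Sign : Set where
  plus minus : Sign

SArc : ∀ {n} → Digraph n → Sign → Fin n → Fin n → Set
SArc D plus  x y = Arc D x y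
SArc D minus x y = Arc D y x

N : ∀ {n} → Digraph n → Sign → Fin n → Subset n
N D plus  x = tabulate (λ y → ⌊ arc? D x y ⌋)
N D minus x = tabulate (λ y → ⌊ arc? D y x ⌋)

-- D contains one of the orientations of K_{2,s} in which each vertex of the
-- class of size two is a source (out-only) or a sink (in-only): distinct
-- u, v, and s distinct vertices w_1..w_s different from u and v, such that
-- every arc between u and the w_i goes in direction σu, and similarly for v.
ContainsK2s : ∀ {n} → Digraph n → ℕ → Set
ContainsK2s {n} D s =
  Σ (Fin n) λ u → Σ (Fin n) λ v → Σ (Fin s → Fin n) λ w →
  Σ Sign λ σu → Σ Sign λ σv →
    (u ≢ v) × Injective _≡_ _≡_ w
    × ((i : Fin s) → (w i ≢ u) × (w i ≢ v))
    × ((i : Fin s) → SArc D σu u (w i) × SArc D σv v (w i))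

K2s-free : ∀ {n} → Digraph n → ℕ → Set
K2s-free D s = ¬ ContainsK2s D s

ceil12 : ℕ → ℕ
ceil12 k = (k + 11) / 12

{-# OPTIONS --safe #-}
module Submission where

-- Write A, B, C for the three signed neighbourhoods. A vertex of S lying in j of them is
-- counted j times in |A ∩ S| + |B ∩ S| + |C ∩ S| and at least 1 + j (j - 1) / 2 ≥ j times
-- in |S| + |A ∩ B| + |A ∩ C| + |B ∩ C|. Two distinct vertices with s common signed
-- neighbours span one of the forbidden orientations of K_{2,s}, so each pairwise
-- intersection has fewer than s = ⌈k/12⌉ elements, and 12 (s - 1) < k turns the
-- bound into 4 (|A ∩ S| + |B ∩ S| + |C ∩ S|) < 4k + k.

open import Defs
open import Data.Nat using (ℕ; zero; suc; _+_; _*_; _≤_; _<_; z≤n; s≤s; _≤?_)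
open import Data.Nat.Properties hiding (suc-injective)
open import Data.Nat.DivMod using (m/n*n≤m)
open import Data.Nat.Tactic.RingSolver using (solve-∀)
open import Data.Bool using (Bool; true; false; _∧_; T)
open import Data.Bool.Properties using (T-≡)
open import Data.Unit using (tt)
open import Data.Fin using (Fin; zero; suc)
open import Data.Fin.Properties using (suc-injective)
open import Data.Fin.Subset using (Subset; _∩_; ∣_∣; _∈_; inside; outside)
open import Data.Fin.Subset.Properties using (x∈p∩q⁻)
open import Data.Vec using ([]; _∷_; tabulate; here; there)
open import Data.Vec.Properties using ([]=⇒lookup; lookup∘tabulate)
open import Data.Product using (Σ; _×_; _,_)
open import Relation.Nullary using (¬_; yes; no; contradiction)
open import Relation.Nullary.Decidable using (toWitness)
open import Relation.Binary.PropositionalEquality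
  using (_≡_; _≢_; refl; sym; trans; cong; subst₂)
open import Function using (_∘_)
open import Function.Bundles using (Equivalence)
open import Function.Definitions using (Injective)

bit : Bool → ℕ
bit true  = 1
bit false = 0

∣x∷p∣≡bit-x+∣p∣ : ∀ {n} x (p : Subset n) → ∣ x ∷ p ∣ ≡ bit x + ∣ p ∣
∣x∷p∣≡bit-x+∣p∣ true  p = refl
∣x∷p∣≡bit-x+∣p∣ false p = refl

+-mono-≤-regroup : ∀ a b c d e f g a′ b′ c′ d′ e′ f′ g′ →
  a + b + c ≤ d + (e + f + g) → a′ + b′ + c′ ≤ d′ + (e′ + f′ + g′) →
  (a + a′) + (b + b′) + (c + c′) ≤ (d + d′) + ((e + e′) + (f + f′) + (g + g′))
+-mono-≤-regroup a b c d e f g a′ b′ c′ d′ e′ f′ g′ h h′ =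
  subst₂ _≤_ (lhs a b c a′ b′ c′) (rhs d e f g d′ e′ f′ g′) (+-mono-≤ h h′)
  where
  lhs : ∀ a b c a′ b′ c′ → (a + b + c) + (a′ + b′ + c′) ≡ (a + a′) + (b + b′) + (c + c′)
  lhs = solve-∀
  rhs : ∀ d e f g d′ e′ f′ g′ →
    (d + (e + f + g)) + (d′ + (e′ + f′ + g′)) ≡ (d + d′) + ((e + e′) + (f + f′) + (g + g′))
  rhs = solve-∀

∣p∩t∣+∣q∩t∣+∣r∩t∣≤∣t∣+∣p∩q∣+∣p∩r∣+∣q∩r∣ : ∀ {n} (p q r t : Subset n) →
  ∣ p ∩ t ∣ + ∣ q ∩ t ∣ + ∣ r ∩ t ∣ ≤ ∣ t ∣ + (∣ p ∩ q ∣ + ∣ p ∩ r ∣ + ∣ q ∩ r ∣)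
∣p∩t∣+∣q∩t∣+∣r∩t∣≤∣t∣+∣p∩q∣+∣p∩r∣+∣q∩r∣ [] [] [] [] = z≤n
∣p∩t∣+∣q∩t∣+∣r∩t∣≤∣t∣+∣p∩q∣+∣p∩r∣+∣q∩r∣ (x ∷ p) (y ∷ q) (z ∷ r) (w ∷ t)
  rewrite ∣x∷p∣≡bit-x+∣p∣ (x ∧ w) (p ∩ t) | ∣x∷p∣≡bit-x+∣p∣ (y ∧ w) (q ∩ t)
        | ∣x∷p∣≡bit-x+∣p∣ (z ∧ w) (r ∩ t) | ∣x∷p∣≡bit-x+∣p∣ w t
        | ∣x∷p∣≡bit-x+∣p∣ (x ∧ y) (p ∩ q) | ∣x∷p∣≡bit-x+∣p∣ (x ∧ z) (p ∩ r)
        | ∣x∷p∣≡bit-x+∣p∣ (y ∧ z) (q ∩ r)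
  = +-mono-≤-regroup (bit (x ∧ w)) (bit (y ∧ w)) (bit (z ∧ w))
                     (bit w) (bit (x ∧ y)) (bit (x ∧ z)) (bit (y ∧ z))
                     (∣ p ∩ t ∣) (∣ q ∩ t ∣) (∣ r ∩ t ∣)
                     (∣ t ∣) (∣ p ∩ q ∣) (∣ p ∩ r ∣) (∣ q ∩ r ∣)
                     (head x y z w)
                     (∣p∩t∣+∣q∩t∣+∣r∩t∣≤∣t∣+∣p∩q∣+∣p∩r∣+∣q∩r∣ p q r t)
  where
  head : ∀ x y z w →
    bit (x ∧ w) + bit (y ∧ w) + bit (z ∧ w) ≤ bit w + (bit (x ∧ y) + bit (x ∧ z) + bit (y ∧ z))
  head true  true  true  true  = ≤ᵇ⇒≤ _ _ tt
  head true  true  true  false = ≤ᵇ⇒≤ _ _ tt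
  head true  true  false true  = ≤ᵇ⇒≤ _ _ tt
  head true  true  false false = ≤ᵇ⇒≤ _ _ tt
  head true  false true  true  = ≤ᵇ⇒≤ _ _ tt
  head true  false true  false = ≤ᵇ⇒≤ _ _ tt
  head true  false false true  = ≤ᵇ⇒≤ _ _ tt
  head true  false false false = ≤ᵇ⇒≤ _ _ tt
  head false true  true  true  = ≤ᵇ⇒≤ _ _ tt
  head false true  true  false = ≤ᵇ⇒≤ _ _ tt
  head false true  false true  = ≤ᵇ⇒≤ _ _ tt
  head false true  false false = ≤ᵇ⇒≤ _ _ tt
  head false false true  true  = ≤ᵇ⇒≤ _ _ tt
  head false false true  false = ≤ᵇ⇒≤ _ _ tt
  head false false false true  = ≤ᵇ⇒≤ _ _ tt
  head false false false false = ≤ᵇ⇒≤ _ _ tt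

m≤∣p∣⇒injection : ∀ {n} m (p : Subset n) → m ≤ ∣ p ∣ →
  Σ (Fin m → Fin n) λ w → Injective _≡_ _≡_ w × (∀ i → w i ∈ p)
m≤∣p∣⇒injection zero    p             _       = (λ ()) , (λ {i} → λ {}) , (λ ())
m≤∣p∣⇒injection (suc m) (outside ∷ p) m<∣p∣   with m≤∣p∣⇒injection (suc m) p m<∣p∣
... | w , w-inj , w∈p = suc ∘ w , w-inj ∘ suc-injective , there ∘ w∈p
m≤∣p∣⇒injection (suc m) (inside ∷ p) (s≤s m≤∣p∣) with m≤∣p∣⇒injection m p m≤∣p∣
... | w , w-inj , w∈p = w′ , w′-inj , w′∈p
  where
  w′ : Fin (suc m) → Fin _
  w′ zero    = zero
  w′ (suc i) = suc (w i)
  w′-inj : Injective _≡_ _≡_ w′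
  w′-inj {zero}  {zero}  _  = refl
  w′-inj {suc i} {suc j} eq = cong suc (w-inj (suc-injective eq))
  w′∈p : ∀ i → w′ i ∈ (inside ∷ p)
  w′∈p zero    = here
  w′∈p (suc i) = there (w∈p i)

∈tabulate⇒T : ∀ {n} (f : Fin n → Bool) {y} → y ∈ tabulate f → T (f y)
∈tabulate⇒T f {y} y∈f =
  Equivalence.from T-≡ (trans (sym (lookup∘tabulate f y)) ([]=⇒lookup y∈f))

∈N⇒SArc : ∀ {n} (D : Digraph n) σ x {y} → y ∈ N D σ x → SArc D σ x y
∈N⇒SArc D plus  x {y} y∈N = toWitness {a? = arc? D x y} (∈tabulate⇒T _ y∈N)
∈N⇒SArc D minus x {y} y∈N = toWitness {a? = arc? D y x} (∈tabulate⇒T _ y∈N)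

SArc-irrefl : ∀ {n} (D : Digraph n) σ x → ¬ SArc D σ x x
SArc-irrefl D plus  = noLoops D
SArc-irrefl D minus = noLoops D

K2s-free⇒∣N∩N∣<s : ∀ {n} (D : Digraph n) {s} → K2s-free D s →
  ∀ {u v} → u ≢ v → ∀ σu σv → ∣ N D σu u ∩ N D σv v ∣ < s
K2s-free⇒∣N∩N∣<s D {s} free {u} {v} u≢v σu σv with s ≤? ∣ N D σu u ∩ N D σv v ∣
... | no  s≰∣N∩N∣ = ≰⇒> s≰∣N∩N∣
... | yes s≤∣N∩N∣ with m≤∣p∣⇒injection s _ s≤∣N∩N∣
...   | w , w-inj , w∈N∩N =
  contradiction (u , v , w , σu , σv , u≢v , (λ {i j} → w-inj) , w≢u,v , arcs) free
  where
  arcs : ∀ i → SArc D σu u (w i) × SArc D σv v (w i)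
  arcs i with x∈p∩q⁻ (N D σu u) (N D σv v) (w∈N∩N i)
  ... | w∈Nu , w∈Nv = ∈N⇒SArc D σu u w∈Nu , ∈N⇒SArc D σv v w∈Nv
  w≢u,v : ∀ i → (w i ≢ u) × (w i ≢ v)
  w≢u,v i with arcs i
  ... | u→w , v→w = (λ { refl → SArc-irrefl D σu u u→w })
                  , (λ { refl → SArc-irrefl D σv v v→w })

4*[x+y+z]<k : ∀ {k x y z} → x < ceil12 k → y < ceil12 k → z < ceil12 k → 4 * (x + y + z) < k
4*[x+y+z]<k {k} {x} {y} {z} x<s y<s z<s = +-cancelˡ-≤ 11 _ _ (begin
  12 + 4 * (x + y + z)         ≡⟨ shift x y z ⟩
  4 * (suc x + suc y + suc z)  ≤⟨ *-monoʳ-≤ 4 (+-mono-≤ (+-mono-≤ x<s y<s) z<s) ⟩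
  4 * (s + s + s)              ≡⟨ triple s ⟩
  s * 12                       ≤⟨ m/n*n≤m (k + 11) 12 ⟩
  k + 11                       ≡⟨ +-comm k 11 ⟩
  11 + k                       ∎)
  where
  open ≤-Reasoning
  s : ℕ
  s = ceil12 k
  shift : ∀ x y z → 12 + 4 * (x + y + z) ≡ 4 * (suc x + suc y + suc z)
  shift = solve-∀
  triple : ∀ s → 4 * (s + s + s) ≡ s * 12
  triple = solve-∀

lemma6p3 : (k : ℕ) → 1 ≤ k → (n : ℕ) → (D : Digraph n) → K2s-free D (ceil12 k)
    → (S : Subset n) → ∣ S ∣ ≤ k
    → (a b c : Fin n) → a ≢ b → a ≢ c → b ≢ c
    → (σa σb σc : Sign)
    → 4 * (∣ N D σa a ∩ S ∣ + ∣ N D σb b ∩ S ∣ + ∣ N D σc c ∩ S ∣) < 5 * k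
lemma6p3 k _ n D free S ∣S∣≤k a b c a≢b a≢c b≢c σa σb σc = begin-strict
  4 * (∣ A ∩ S ∣ + ∣ B ∩ S ∣ + ∣ C ∩ S ∣)
    ≤⟨ *-monoʳ-≤ 4 (∣p∩t∣+∣q∩t∣+∣r∩t∣≤∣t∣+∣p∩q∣+∣p∩r∣+∣q∩r∣ A B C S) ⟩
  4 * (∣ S ∣ + (∣ A ∩ B ∣ + ∣ A ∩ C ∣ + ∣ B ∩ C ∣))
    ≡⟨ *-distribˡ-+ 4 ∣ S ∣ _ ⟩
  4 * ∣ S ∣ + 4 * (∣ A ∩ B ∣ + ∣ A ∩ C ∣ + ∣ B ∩ C ∣)
    <⟨ +-mono-≤-< (*-monoʳ-≤ 4 ∣S∣≤k)
                  (4*[x+y+z]<k (common a≢b σa σb) (common a≢c σa σc) (common b≢c σb σc)) ⟩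
  4 * k + k
    ≡⟨ +-comm (4 * k) k ⟩
  5 * k ∎
  where
  open ≤-Reasoning
  A B C : Subset n
  A = N D σa a
  B = N D σb b
  C = N D σc c
  common : ∀ {u v} → u ≢ v → ∀ σu σv → ∣ N D σu u ∩ N D σv v ∣ < ceil12 k
  common = K2s-free⇒∣N∩N∣<s D free
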